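{- Let $\mathcal{S}=\langle\mathcal{L},\vdash\rangle$ be a logic such that $\mathcal{L}$ has at least two distinct elements. If spECQ holds in $\mathcal{S}$, then gECQ holds in $\mathcal{S}$. Moreover, if $\mathcal{L}$ has at least three distinct elements, then sECQ also holds in $\mathcal{S}$.
   Context: A logic is a pair $\langle\mathcal{L},\vdash\rangle$ with $\mathcal{L}$ a set and $\vdash\,\subseteq\mathcal{P}(\mathcal{L})\times\mathcal{L}$; $C_\vdash(\Gamma)=\{\alpha:\Gamma\vdash\alpha\}$. gECQ: for each $\alpha\in\mathcal{L}$ there is $\beta\in\mathcal{L}$ with $C_\vdash(\{\alpha,\beta\})=\mathcal{L}$. sECQ: for each $\alpha\in\mathcal{L}$ there is $\Gamma\subsetneq\mathcal{L}$ with $\alpha\in\Gamma$ and $C_\vdash(\Gamma)=\mathcal{L}$. spECQ: for every $\Gamma\subsetneq\mathcal{L}$ there is $\alpha\in\mathcal{L}$ with $\Gamma\cup\{\alpha\}\subsetneq\mathcal{L}$ and $C_\vdash(\Gamma\cup\{\alpha\})=\mathcal{L}$. -}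

module Defs where

open import Level using (0ℓ)
open import Data.Product using (Σ; _×_)
open import Relation.Nullary using (¬_)
open import Relation.Unary using (Pred; _∈_; _∪_; ｛_｝)
open import Relation.Binary.PropositionalEquality using (_≡_)

record Logic : Set₁ where
  field
    Form : Set
    _⊢_  : Pred Form 0ℓ → Form → Set

module _ (S : Logic) where
  open Logic S

  Explosive : Pred Form 0ℓ → Set
  Explosive Γ = ∀ α → Γ ⊢ α

  Proper : Pred Form 0ℓ → Set
  Proper Γ = ¬ (∀ α → α ∈ Γ)

  gECQ : Set
  gECQ = ∀ α → Σ Form λ β → Explosive (｛ α ｝ ∪ ｛ β ｝)

  sECQ : Set₁
  sECQ = ∀ α → Σ (Pred Form 0ℓ) λ Γ → Proper Γ × α ∈ Γ × Explosive Γ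

  spECQ : Set₁
  spECQ = ∀ (Γ : Pred Form 0ℓ) → Proper Γ →
          Σ Form λ α → Proper (Γ ∪ ｛ α ｝) × Explosive (Γ ∪ ｛ α ｝)

  AtLeastTwo : Set
  AtLeastTwo = Σ Form λ a → Σ Form λ b → ¬ a ≡ b

  AtLeastThree : Set
  AtLeastThree = Σ Form λ a → Σ Form λ b → Σ Form λ c →
                 (¬ a ≡ b) × (¬ a ≡ c) × (¬ b ≡ c)

{-# OPTIONS --safe #-}
module Submission where

-- Two distinct formulas make every singleton {α} a proper subset, so spECQ
-- applies to it and yields β with {α, β} proper and explosive. That β
-- witnesses gECQ, and {α, β} itself witnesses sECQ.

open import Defs
open import Data.Product using (Σ; _×_; _,_)
open import Data.Sum using (inj₁)
open import Relation.Binary.PropositionalEquality using (refl; trans; sym)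
open import Relation.Unary using (｛_｝; _∪_)

module _ (S : Logic) where
  open Logic S

  singleton-proper : AtLeastTwo S → ∀ α → Proper S ｛ α ｝
  singleton-proper (a , b , a≢b) α all = a≢b (trans (sym (all a)) (all b))

  spECQ-partner : AtLeastTwo S → spECQ S → ∀ α →
    Σ Form λ β → Proper S (｛ α ｝ ∪ ｛ β ｝) × Explosive S (｛ α ｝ ∪ ｛ β ｝)
  spECQ-partner two sp α = sp ｛ α ｝ (singleton-proper two α)

  spECQ⇒gECQ : AtLeastTwo S → spECQ S → gECQ S
  spECQ⇒gECQ two sp α with spECQ-partner two sp α
  ... | β , _ , explosive = β , explosive

  spECQ⇒sECQ : AtLeastTwo S → spECQ S → sECQ S
  spECQ⇒sECQ two sp α with spECQ-partner two sp α
  ... | β , proper , explosive = ｛ α ｝ ∪ ｛ β ｝ , proper , inj₁ refl , explosive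

theorem3p8 : (S : Logic) → AtLeastTwo S → spECQ S →
    gECQ S × (AtLeastThree S → sECQ S)
theorem3p8 S two sp = spECQ⇒gECQ S two sp , λ _ → spECQ⇒sECQ S two sp
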